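{- Let $\Gamma$ be a simple digraph and let $\Gamma'$ be a simple digraph obtained from $\Gamma$ either by adding one new vertex together with some (possibly empty) set of arcs between it and vertices of $\Gamma$, or by deleting one vertex of $\Gamma$ together with all arcs incident to it. Then $|\operatorname{th}(\Gamma')-\operatorname{th}(\Gamma)|\le 1$.
   Context: A simple digraph $\Gamma$ has a finite vertex set and no loops or parallel arcs (opposite arcs $(u,v),(v,u)$ allowed). $v$ is an out-neighbor of $u$ if $(u,v)\in E(\Gamma)$. Zero forcing: vertices are blue or white; a blue vertex $u$ with exactly one white out-neighbor $w$ may force $w$ ($u\to w$), turning it blue. A set $\mathcal F$ of forces is a set of forces of $B\subseteq V(\Gamma)$ if, starting with exactly $B$ blue, the forces in $\mathcal F$ can be validly performed in some order after which no further force is possible. Put $\mathcal F^{[0]}=B$ and $\mathcal F^{[t+1]}=\mathcal F^{[t]}\cup\{w\notin\mathcal F^{[t]}:(u\to w)\in\mathcal F,\ u\in\mathcal F^{[t]},\ w$ the only out-neighbor of $u$ outside $\mathcal F^{[t]}\}$; $\operatorname{pt}(\Gamma;\mathcal F)$ is the least $t$ with $\mathcal F^{[t]}=V(\Gamma)$ ($\infty$ if none). $\operatorname{pt}(\Gamma;B)=\min_{\mathcal F}\operatorname{pt}(\Gamma;\mathcal F)$ over sets of forces of $B$. The throttling number is $\operatorname{th}(\Gamma)=\min_{B\subseteq V(\Gamma)}(|B|+\operatorname{pt}(\Gamma;B))$. -}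

module Defs where

open import Data.Nat using (ℕ; zero; suc; _+_; _≤_)
open import Data.Bool using (Bool; true; false)
open import Data.Fin using (Fin; punchIn)
open import Data.Fin.Subset using (Subset; inside; ∣_∣) renaming (_∈_ to _∈ₛ_; _∉_ to _∉ₛ_)
open import Data.Vec using (_[_]≔_)
open import Data.List using (List; []; _∷_)
open import Data.List.Membership.Propositional using () renaming (_∈_ to _∈ₗ_)
open import Data.Product using (Σ; ∃; _×_; _,_)
open import Data.Sum using (_⊎_)
open import Relation.Nullary using (¬_)
open import Relation.Binary.PropositionalEquality using (_≡_)

-- A simple digraph on vertex set Fin n: an arc relation (Bool-valued, so no
-- parallel arcs) with no loops.  Opposite arcs are allowed.
record Digraph (n : ℕ) : Set where
  field
    adj      : Fin n → Fin n → Bool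
    loopless : ∀ i → adj i i ≡ false
open Digraph public

Force : ℕ → Set
Force n = Fin n × Fin n

CanForce : ∀ {n} → Digraph n → Subset n → Fin n → Fin n → Set
CanForce Γ S u w =
  u ∈ₛ S × w ∉ₛ S × adj Γ u w ≡ true ×
  (∀ x → adj Γ u x ≡ true → x ∉ₛ S → x ≡ w)

Terminal : ∀ {n} → Digraph n → Subset n → Set
Terminal Γ S = ∀ u w → ¬ CanForce Γ S u w

Run : ∀ {n} → Digraph n → Subset n → List (Force n) → Set
Run Γ S []            = Terminal Γ S
Run Γ S ((u , w) ∷ L) = CanForce Γ S u w × Run Γ (S [ w ]≔ inside) L

-- F (as a set: the elements of the list) is a set of forces of B if its
-- forces can be performed in some order (w.l.o.g. the listed one, since the
-- set of elements is what matters) ending in a terminal state.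
IsForceSetOf : ∀ {n} → Digraph n → Subset n → List (Force n) → Set
IsForceSetOf Γ B F = Σ (List (Force _)) λ L →
  (∀ f → f ∈ₗ F → f ∈ₗ L) × (∀ f → f ∈ₗ L → f ∈ₗ F) × Run Γ B L

Stage : ∀ {n} → Digraph n → Subset n → List (Force n) → ℕ → Fin n → Set
Stage Γ B F zero    x = x ∈ₛ B
Stage Γ B F (suc t) x =
  Stage Γ B F t x ⊎
  (∃ λ u → (u , x) ∈ₗ F × Stage Γ B F t u × ¬ Stage Γ B F t x ×
           adj Γ u x ≡ true ×
           (∀ y → adj Γ u y ≡ true → ¬ Stage Γ B F t y → y ≡ x))

StageFull : ∀ {n} → Digraph n → Subset n → List (Force n) → ℕ → Set
StageFull Γ B F t = ∀ x → Stage Γ B F t x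

-- k = |B| + t is attained: some B, some set of forces F of B and some t
-- with F^[t] = V(Γ).  (Minimising over such triples is exactly
-- min_B (|B| + min_F pt(Γ;F)); B with pt(Γ;B) = ∞ contribute nothing.)
Attains : ∀ {n} → Digraph n → ℕ → Set
Attains {n} Γ k = Σ (Subset n) λ B → Σ (List (Force n)) λ F → Σ ℕ λ t →
  IsForceSetOf Γ B F × StageFull Γ B F t × ∣ B ∣ + t ≡ k

IsThrottlingNumber : ∀ {n} → Digraph n → ℕ → Set
IsThrottlingNumber Γ k = Attains Γ k × (∀ m → Attains Γ m → k ≤ m)

-- Γ with vertex v deleted (vertices of the result are identified with
-- V(Γ) ∖ {v} via punchIn v).
DeletionOf : ∀ {n} → Digraph (suc n) → Fin (suc n) → Digraph n → Set
DeletionOf G v H = ∀ i j → adj H i j ≡ adj G (punchIn v i) (punchIn v j)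

module Submission where

-- A "stage witness" for a digraph Γ is a triple (B, F, t) with F^[t] = V(Γ),
-- where F is an arbitrary list of forces.  The proof rests on three facts.
--
-- (1) Realization.  Every stage witness (B, F, t) gives Attains Γ (|B| + t):
--     performing, round after round, one justifying force for each vertex
--     that enters F^[s+1] is a genuine set of forces of B whose stages contain
--     those of F.  Hence th(Γ) ≤ |B| + t for every stage witness.
-- (2) Adding v.  A witness (B', F', t') of H lifts to the witness
--     (B' ∪ {v}, all forces, t') of G; so th(G) ≤ th(H) + 1.
-- (3) Deleting v.  If (B, F, t) is attained in G by a set of forces, then v
--     performs at most one force v → w; (B ∖ {v}) ∪ {w} with all forces is a
--     witness of H with the same t; so th(H) ≤ th(G) + 1.

open import Defs
open import Data.Nat using (ℕ; zero; suc; _+_; _≤_; z≤n; s≤s; _≤?_)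
open import Data.Nat.Properties
  using (≤-trans; m≤n⇒m≤1+n; +-monoˡ-≤; +-suc; +-identityʳ;
         ≰⇒>; m≤n⇒∃[o]m+o≡n; +-comm)
open import Data.Bool using (true)
open import Data.Bool.Properties using () renaming (_≟_ to _≟ᴮ_)
open import Data.Fin using (Fin; punchIn; punchOut) renaming (zero to fzero; suc to fsuc)
open import Data.Fin.Properties
  using (any?; all?; punchIn-injective; punchInᵢ≢i; punchIn-punchOut; punchOut-punchIn)
  renaming (_≟_ to _≟ᶠ_)
open import Data.Fin.Subset using (Subset; inside; outside; ∣_∣) renaming (_∈_ to _∈ₛ_; _∉_ to _∉ₛ_)
open import Data.Fin.Subset.Properties using (_∈?_; ∣p∣≤∣x∷p∣)
open import Data.Vec using (_∷_; lookup; _[_]≔_; insertAt; removeAt)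
open import Data.Vec.Properties
  using ([]=⇒lookup; lookup⇒[]=; insertAt-lookup; insertAt-punchIn; []≔-updates; []≔-minimal;
         lookup∘update′; removeAt-punchOut)
open import Data.List using (List; []; _∷_; _++_; allFin; cartesianProduct)
open import Data.List.Membership.Propositional using () renaming (_∈_ to _∈ₗ_)
open import Data.List.Membership.Propositional.Properties
  using (∈-allFin; ∈-cartesianProduct⁺; ∈-++⁺ˡ; ∈-++⁺ʳ)
import Data.List.Membership.DecPropositional as DecMembership
open import Data.List.Relation.Unary.Any using (here; there)
open import Data.Product using (Σ; _×_; _,_; proj₁; proj₂)
open import Data.Product.Properties using (≡-dec)
open import Data.Sum using (_⊎_; inj₁; inj₂; [_,_]′)
open import Data.Empty using (⊥-elim)
open import Function using (id; _∘_)
open import Relation.Nullary using (¬_; Dec; yes; no)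
open import Relation.Nullary.Decidable using (_⊎-dec_; _×-dec_; _→-dec_; ¬?)
open import Relation.Binary.PropositionalEquality using (_≡_; refl; sym; trans; cong; subst)

ForcesAt : ∀ {n} → Digraph n → Subset n → List (Force n) → ℕ → Fin n → Fin n → Set
ForcesAt Γ B F t u x =
  Stage Γ B F t u × ¬ Stage Γ B F t x × adj Γ u x ≡ true ×
  (∀ y → adj Γ u y ≡ true → ¬ Stage Γ B F t y → y ≡ x)

_∈F?_ : ∀ {n} (f : Force n) (F : List (Force n)) → Dec (f ∈ₗ F)
_∈F?_ = DecMembership._∈?_ (≡-dec _≟ᶠ_ _≟ᶠ_)

-- Membership in a stage is decidable (all quantifiers range over Fin n).
stage? : ∀ {n} (Γ : Digraph n) B F t x → Dec (Stage Γ B F t x)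
stage? Γ B F zero    x = x ∈? B
stage? Γ B F (suc t) x = stage? Γ B F t x ⊎-dec any? λ u →
  ((u , x) ∈F? F) ×-dec stage? Γ B F t u ×-dec ¬? (stage? Γ B F t x) ×-dec
  (adj Γ u x ≟ᴮ true) ×-dec
  all? (λ y → (adj Γ u y ≟ᴮ true) →-dec (¬? (stage? Γ B F t y) →-dec (y ≟ᶠ x)))

stage-mono : ∀ {n} {Γ : Digraph n} {B F r s} x → r ≤ s → Stage Γ B F r x → Stage Γ B F s x
stage-mono {Γ = Γ} {B} {F} {r} x r≤s p with m≤n⇒∃[o]m+o≡n r≤s
... | d , refl = subst (λ m → Stage Γ B F m x) (+-comm d r) (later d)
  where
  later : ∀ d → Stage Γ B F (d + r) x
  later zero    = p
  later (suc d) = inj₁ (later d)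

-- The list of all forces on Fin n: with it, any valid force may be used
-- when computing stages.
allForces : ∀ n → List (Force n)
allForces n = cartesianProduct (allFin n) (allFin n)

∈-allForces : ∀ {n} (f : Force n) → f ∈ₗ allForces n
∈-allForces (u , w) = ∈-cartesianProduct⁺ (∈-allFin u) (∈-allFin w)

paint-mono : ∀ {n} (S : Subset n) w x → x ∈ₛ S → x ∈ₛ (S [ w ]≔ inside)
paint-mono S w x x∈S with w ≟ᶠ x
... | yes refl = []≔-updates S w
... | no w≢x   = []≔-minimal S x w (w≢x ∘ sym) x∈S

paint-inv : ∀ {n} (S : Subset n) w x → x ∈ₛ (S [ w ]≔ inside) → x ∈ₛ S ⊎ x ≡ w
paint-inv S w x x∈S' with x ≟ᶠ w
... | yes x≡w = inj₂ x≡w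
... | no x≢w  = inj₁ (lookup⇒[]= x S (trans (sym (lookup∘update′ x≢w S inside)) ([]=⇒lookup x∈S')))

Steps : ∀ {n} → Digraph n → Subset n → List (Force n) → Subset n → Set
Steps Γ S []            S' = S ≡ S'
Steps Γ S ((u , w) ∷ L) S' = CanForce Γ S u w × Steps Γ (S [ w ]≔ inside) L S'

steps-run : ∀ {n} {Γ : Digraph n} {S S'} L {L'} → Steps Γ S L S' → Run Γ S' L' → Run Γ S (L ++ L')
steps-run []            refl         run = run
steps-run ((u , w) ∷ L) (force , st) run = force , steps-run L st run

run-target : ∀ {n} {Γ : Digraph n} {S} L {u x} → Run Γ S L → (u , x) ∈ₗ L →
             x ∉ₛ S × adj Γ u x ≡ true
run-target ((u , w) ∷ L) ((_ , w∉S , uw , _) , _) (here refl) = w∉S , uw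
run-target {S = S} ((_ , w) ∷ L) (_ , run) (there m) with run-target L run m
... | x∉S' , ux = (λ x∈S → x∉S' (paint-mono S w _ x∈S)) , ux

run-force-unique : ∀ {n} {Γ : Digraph n} {S} L {u x y} → Run Γ S L →
                   (u , x) ∈ₗ L → (u , y) ∈ₗ L → x ≡ y
run-force-unique ((u , w) ∷ L) _ (here refl) (here refl) = refl
run-force-unique {S = S} ((u , w) ∷ L) ((_ , _ , _ , only) , run) (here refl) (there m)
  with run-target L run m
... | y∉S' , uy = sym (only _ uy (λ y∈S → y∉S' (paint-mono S w _ y∈S)))
run-force-unique {S = S} ((u , w) ∷ L) ((_ , _ , _ , only) , run) (there m) (here refl)
  with run-target L run m
... | x∉S' , ux = only _ ux (λ x∈S → x∉S' (paint-mono S w _ x∈S))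
run-force-unique (_ ∷ L) (_ , run) (there m) (there m') = run-force-unique L run m m'

module Realization {n} (Γ : Digraph n) (B : Subset n) (F : List (Force n)) where

  St : ℕ → Fin n → Set
  St = Stage Γ B F

  Justified : List (Force n) → Fin n → Set
  Justified L x = Σ ℕ λ r → Σ (Fin n) λ u → (u , x) ∈ₗ L × ForcesAt Γ B F r u x

  Reaches : Subset n → (Fin n → Set) → Set
  Reaches S P = Σ (List (Force n)) λ L → Σ (Subset n) λ S' →
    Steps Γ S L S' × (∀ x → P x → x ∈ₛ S') × (∀ x → x ∈ₛ S' → x ∈ₛ S ⊎ Justified L x)

  Realizes : Subset n → Set
  Realizes S = Σ (List (Force n)) λ L → Run Γ S L × (∀ x → x ∈ₛ S ⊎ Justified L x)

  discharge : ∀ {P : Fin n → Set} {S S' x xs} → (∀ y → y ∈ₛ S → y ∈ₛ S') → (P x → x ∈ₛ S') →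
              (∀ y → P y → y ∈ₛ S ⊎ y ∈ₗ x ∷ xs) → ∀ y → P y → y ∈ₛ S' ⊎ y ∈ₗ xs
  discharge S⊆S' Px⊆S' todo y Py with todo y Py
  ... | inj₁ y∈S          = inj₁ (S⊆S' y y∈S)
  ... | inj₂ (here refl)  = inj₁ (Px⊆S' Py)
  ... | inj₂ (there y∈xs) = inj₂ y∈xs

  -- One round: from a blue set containing F^[s], every vertex of F^[s+1]
  -- in the to-do list xs can be made blue, each by the force that put it
  -- into F^[s+1] (its forcer is blue, its other out-neighbours are in F^[s]).
  round : ∀ s (xs : List (Fin n)) S → (∀ x → St s x → x ∈ₛ S) →
          (∀ x → St (suc s) x → x ∈ₛ S ⊎ x ∈ₗ xs) → Reaches S (St (suc s))
  round s [] S _ todo = [] , S , refl , (λ x p → [ id , (λ ()) ]′ (todo x p)) , (λ x → inj₁)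
  round s (x ∷ xs) S St⊆S todo with x ∈? S | stage? Γ B F (suc s) x
  ... | yes x∈S | _ = round s xs S St⊆S (discharge (λ _ → id) (λ _ → x∈S) todo)
  ... | no _ | no x∉St = round s xs S St⊆S (discharge (λ _ → id) (⊥-elim ∘ x∉St) todo)
  ... | no x∉S | yes (inj₁ x∈St) = ⊥-elim (x∉S (St⊆S x x∈St))
  ... | no x∉S | yes (inj₂ (u , _ , ux@(u∈St , _ , u→x , only)))
    with round s xs (S [ x ]≔ inside) (λ y → paint-mono S x y ∘ St⊆S y)
               (discharge (paint-mono S x) (λ _ → []≔-updates S x) todo)
  ... | L , S' , steps , St⊆S' , origin =
        (u , x) ∷ L , S' , (force , steps) , St⊆S' , origin′
    where
    force : CanForce Γ S u x
    force = St⊆S u u∈St , x∉S , u→x , λ y uy y∉S → only y uy (y∉S ∘ St⊆S y)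
    origin′ : ∀ y → y ∈ₛ S' → y ∈ₛ S ⊎ Justified ((u , x) ∷ L) y
    origin′ y y∈S' with origin y y∈S'
    ... | inj₂ (r , w , m , wy) = inj₂ (r , w , there m , wy)
    ... | inj₁ y∈S″ with paint-inv S x y y∈S″
    ...   | inj₁ y∈S = inj₁ y∈S
    ...   | inj₂ refl = inj₂ (s , u , here refl , ux)

  rounds : ∀ k s S → (∀ x → St s x → x ∈ₛ S) → (∀ x → St (k + s) x) → Realizes S
  rounds zero s S St⊆S full =
    [] , (λ u w force → proj₁ (proj₂ force) (St⊆S w (full w))) , (λ x → inj₁ (St⊆S x (full x)))
  rounds (suc k) s S St⊆S full
    with round s (allFin n) S St⊆S (λ x _ → inj₂ (∈-allFin x))
  ... | L , S' , steps , St⊆S' , origin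
    with rounds k (suc s) S' St⊆S' (λ x → subst (λ m → St m x) (sym (+-suc k s)) (full x))
  ... | L' , run , origin' = L ++ L' , steps-run L steps run , origin″
    where
    origin″ : ∀ x → x ∈ₛ S ⊎ Justified (L ++ L') x
    origin″ x with origin' x
    ... | inj₂ (r , u , m , ux) = inj₂ (r , u , ∈-++⁺ʳ L m , ux)
    ... | inj₁ x∈S' with origin x x∈S'
    ...   | inj₁ x∈S = inj₁ x∈S
    ...   | inj₂ (r , u , m , ux) = inj₂ (r , u , ∈-++⁺ˡ m , ux)

  -- If every vertex is in B or justified in L, the stages of L contain
  -- those of F: the justifying forcer of x entered the stages no later.
  stage-justified : ∀ L → (∀ x → x ∈ₛ B ⊎ Justified L x) → ∀ s x → St s x → Stage Γ B L s x
  stage-justified L origin zero x x∈B = x∈B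
  stage-justified L origin (suc s) x (inj₁ x∈St) = inj₁ (stage-justified L origin s x x∈St)
  stage-justified L origin (suc s) x (inj₂ forced) with origin x
  ... | inj₁ x∈B = stage-mono {F = L} x z≤n x∈B
  ... | inj₂ (r , u , m , u∈Stʳ , x∉Stʳ , ux , only) with r ≤? s | stage? Γ B L s x
  ...   | _        | yes x∈Stᴸ = inj₁ x∈Stᴸ
  ...   | no r≰s   | no _ = ⊥-elim (x∉Stʳ (stage-mono x (≰⇒> r≰s) (inj₂ forced)))
  ...   | yes r≤s  | no x∉Stᴸ =
          inj₂ (u , m , lift u u∈Stʳ , x∉Stᴸ , ux ,
                λ y uy y∉Stᴸ → only y uy (y∉Stᴸ ∘ lift y))
    where
    lift : ∀ y → St r y → Stage Γ B L s y
    lift y = stage-justified L origin s y ∘ stage-mono y r≤s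

  realize : ∀ t → StageFull Γ B F t → Attains Γ (∣ B ∣ + t)
  realize t full
    with rounds t 0 B (λ _ → id) (λ x → subst (λ m → St m x) (sym (+-identityʳ t)) (full x))
  ... | L , run , origin =
    B , L , t , (L , (λ _ → id) , (λ _ → id) , run) ,
    (λ x → stage-justified L origin t x (full x)) , refl

throttling-bound : ∀ {n} {Γ : Digraph n} {k B F t} →
                   IsThrottlingNumber Γ k → StageFull Γ B F t → k ≤ ∣ B ∣ + t
throttling-bound {Γ = Γ} {B = B} {F} {t} (_ , minimal) full =
  minimal _ (Realization.realize Γ B F t full)

∣insertAt-inside∣ : ∀ {n} (B : Subset n) i → ∣ insertAt B i inside ∣ ≡ suc ∣ B ∣
∣insertAt-inside∣ B             fzero    = refl
∣insertAt-inside∣ (inside  ∷ B) (fsuc i) = cong suc (∣insertAt-inside∣ B i)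
∣insertAt-inside∣ (outside ∷ B) (fsuc i) = ∣insertAt-inside∣ B i

∣removeAt∣≤ : ∀ {n} (B : Subset (suc n)) i → ∣ removeAt B i ∣ ≤ ∣ B ∣
∣removeAt∣≤ (x ∷ B)           fzero    = ∣p∣≤∣x∷p∣ x B
∣removeAt∣≤ (inside  ∷ y ∷ B) (fsuc i) = s≤s (∣removeAt∣≤ (y ∷ B) i)
∣removeAt∣≤ (outside ∷ y ∷ B) (fsuc i) = ∣removeAt∣≤ (y ∷ B) i

∣paint∣≤ : ∀ {n} (S : Subset n) i → ∣ S [ i ]≔ inside ∣ ≤ suc ∣ S ∣
∣paint∣≤ (x ∷ S)       fzero    = s≤s (∣p∣≤∣x∷p∣ x S)
∣paint∣≤ (inside  ∷ S) (fsuc i) = s≤s (∣paint∣≤ S i)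
∣paint∣≤ (outside ∷ S) (fsuc i) = ∣paint∣≤ S i

∈-removeAt : ∀ {n} (B : Subset (suc n)) v y → punchIn v y ∈ₛ B → y ∈ₛ removeAt B v
∈-removeAt B v y y∈B = lookup⇒[]= y (removeAt B v)
  (trans (sym (cong (lookup (removeAt B v)) (punchOut-punchIn v)))
         (trans (removeAt-punchOut B (punchInᵢ≢i v y ∘ sym)) ([]=⇒lookup y∈B)))

data VertexView {n} (v : Fin (suc n)) : Fin (suc n) → Set where
  deleted : VertexView v v
  kept    : ∀ y → VertexView v (punchIn v y)

vertexView : ∀ {n} (v z : Fin (suc n)) → VertexView v z
vertexView v z with v ≟ᶠ z
... | yes refl = deleted
... | no v≢z   = subst (VertexView v) (punchIn-punchOut v≢z) (kept (punchOut v≢z))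

module Deletion {n} {G : Digraph (suc n)} {v : Fin (suc n)} {H : Digraph n}
                (del : DeletionOf G v H) where

  -- Adding v to the blue set: stages of H (for any forces) embed into the
  -- stages of G computed with all forces; v itself is blue from the start.
  module Lift (B' : Subset n) (F' : List (Force n)) where

    BG : Subset (suc n)
    BG = insertAt B' v inside

    StG : ℕ → Fin (suc n) → Set
    StG = Stage G BG (allForces (suc n))

    v∈StG : ∀ s → StG s v
    v∈StG s = stage-mono v z≤n (lookup⇒[]= v BG (insertAt-lookup B' v inside))

    -- A force u → y of H is a force of G: the only further out-neighbour
    -- v of punchIn v u is blue.
    stage-lift : ∀ s y → Stage H B' F' s y → StG s (punchIn v y)
    stage-lift zero y y∈B' = lookup⇒[]= _ BG (trans (insertAt-punchIn B' v inside y) ([]=⇒lookup y∈B'))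
    stage-lift (suc s) y (inj₁ y∈St) = inj₁ (stage-lift s y y∈St)
    stage-lift (suc s) y (inj₂ (u , _ , u∈St , _ , uy , only))
      with stage? G BG (allForces (suc n)) s (punchIn v y)
    ... | yes y∈StG = inj₁ y∈StG
    ... | no y∉StG  =
          inj₂ (punchIn v u , ∈-allForces _ , stage-lift s u u∈St , y∉StG , trans (sym (del u y)) uy , only′)
      where
      only′ : ∀ z → adj G (punchIn v u) z ≡ true → ¬ StG s z → z ≡ punchIn v y
      only′ z uz z∉StG with vertexView v z
      ... | deleted = ⊥-elim (z∉StG (v∈StG s))
      ... | kept z₀ = cong (punchIn v) (only z₀ (trans (del u z₀) uz) (z∉StG ∘ stage-lift s z₀))

    full-lift : ∀ t → StageFull H B' F' t → StageFull G BG (allForces (suc n)) t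
    full-lift t full z with vertexView v z
    ... | deleted = v∈StG t
    ... | kept y  = stage-lift t y (full y)

  throttling-after-adding : ∀ {k k'} → IsThrottlingNumber G k → Attains H k' → k ≤ suc k'
  throttling-after-adding {k} thG (B' , F' , t' , _ , full , refl) =
    subst (k ≤_) (cong (_+ t') (∣insertAt-inside∣ B' v))
      (throttling-bound thG (Lift.full-lift B' F' t' full))

  module Restrict (B : Subset (suc n)) (F : List (Force (suc n))) (BH : Subset n)
                  (keeps : ∀ y → punchIn v y ∈ₛ B → y ∈ₛ BH)
                  (absorbs : ∀ y → (v , punchIn v y) ∈ₗ F → y ∈ₛ BH) where

    StH : ℕ → Fin n → Set
    StH = Stage H BH (allForces n)

    -- A force u → y of G with u ≠ v is a force of H; a force v → y is
    -- absorbed by the blue set.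
    stage-restrict : ∀ s y → Stage G B F s (punchIn v y) → StH s y
    stage-restrict zero y y∈B = keeps y y∈B
    stage-restrict (suc s) y (inj₁ y∈St) = inj₁ (stage-restrict s y y∈St)
    stage-restrict (suc s) y (inj₂ (u , uy∈F , u∈St , _ , uy , only)) with vertexView v u
    ... | deleted = stage-mono y z≤n (absorbs y uy∈F)
    ... | kept u₀ with stage? H BH (allForces n) s y
    ...   | yes y∈StH = inj₁ y∈StH
    ...   | no y∉StH  =
            inj₂ (u₀ , ∈-allForces _ , stage-restrict s u₀ u∈St , y∉StH , trans (del u₀ y) uy ,
                  λ z u₀z z∉StH → punchIn-injective v z y
                    (only (punchIn v z) (trans (sym (del u₀ z)) u₀z) (z∉StH ∘ stage-restrict s z)))

    full-restrict : ∀ t → StageFull G B F t → StageFull H BH (allForces n) t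
    full-restrict t full y = stage-restrict t y (full (punchIn v y))

  -- A blue set for H from a set of forces of B in G: B ∖ {v}, plus the
  -- unique vertex forced by v, if any.  It has at most |B| + 1 vertices.
  restricted-blue-set : ∀ {B F} → IsForceSetOf G B F →
    Σ (Subset n) λ BH → ∣ BH ∣ ≤ suc ∣ B ∣ ×
      (∀ y → punchIn v y ∈ₛ B → y ∈ₛ BH) × (∀ y → (v , punchIn v y) ∈ₗ F → y ∈ₛ BH)
  restricted-blue-set {B} (L , F⊆L , _ , run) with any? (λ w → (v , punchIn v w) ∈F? L)
  ... | yes (w , vw∈L) =
        removeAt B v [ w ]≔ inside ,
        ≤-trans (∣paint∣≤ (removeAt B v) w) (s≤s (∣removeAt∣≤ B v)) ,
        (λ y → paint-mono _ w y ∘ ∈-removeAt B v y) ,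
        λ y vy∈F → subst (λ x → x ∈ₛ (removeAt B v [ w ]≔ inside))
          (sym (punchIn-injective v y w (run-force-unique L run (F⊆L _ vy∈F) vw∈L)))
          ([]≔-updates (removeAt B v) w)
  ... | no v-forces-nothing =
        removeAt B v , m≤n⇒m≤1+n (∣removeAt∣≤ B v) , ∈-removeAt B v ,
        λ y vy∈F → ⊥-elim (v-forces-nothing (y , F⊆L _ vy∈F))

  throttling-after-deleting : ∀ {k k'} → IsThrottlingNumber H k' → Attains G k → k' ≤ suc k
  throttling-after-deleting thH (B , F , t , forceSet , full , refl)
    with restricted-blue-set forceSet
  ... | BH , ∣BH∣≤ , keeps , absorbs =
        ≤-trans (throttling-bound thH (Restrict.full-restrict B F BH keeps absorbs t full))
                (+-monoˡ-≤ t ∣BH∣≤)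

proposition2p17 : ∀ n (G : Digraph (suc n)) (v : Fin (suc n)) (H : Digraph n) →
    DeletionOf G v H →
    ∀ k k' → IsThrottlingNumber G k → IsThrottlingNumber H k' →
    k ≤ suc k' × k' ≤ suc k
proposition2p17 n G v H del k k' thG thH =
  throttling-after-adding thG (proj₁ thH) , throttling-after-deleting thH (proj₁ thG)
  where open Deletion {G = G} {v = v} {H = H} del
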